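{- If $A$ is a centrally supplemented Heyting algebra with MacNeille completion $\overline{A}$, then $Z(\overline{A})=\overline{Z(A)}$ (that is, $Z(\overline{A})$ is the MacNeille completion of $Z(A)$), and $Z(\overline{A})$ is a complete subalgebra of $\overline{A}$ (closed under arbitrary joins and meets of $\overline{A}$).
   Context: For an element $a$ of a bounded distributive lattice $D$, the supplement $a^+$ (if it exists) is the least element whose join with $a$ is $1$; $D$ is supplemented if every element has one, and centrally supplemented if it is supplemented and satisfies $(x\vee y)^+=x^+\wedge y^+$. $Z(D)$ denotes the center of $D$, the set of complemented elements, a Boolean algebra. -}

module Defs where

open import Level using (Level; _⊔_; suc)
open import Data.Product using (Σ; _×_; _,_; proj₁)
open import Relation.Binary.Bundles using (Poset)
open import Relation.Binary.Lattice.Bundles using (BoundedLattice; HeytingAlgebra)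
import Relation.Binary.Construct.On as On

module _ {c ℓ₁ ℓ₂ : Level} (P : Poset c ℓ₁ ℓ₂) where
  open Poset P

  IsLub : {ι : Level} {I : Set ι} → (I → Carrier) → Carrier → Set (c ⊔ ℓ₂ ⊔ ι)
  IsLub {I = I} f x = ((i : I) → f i ≤ x) × ((y : Carrier) → ((i : I) → f i ≤ y) → x ≤ y)

  IsGlb : {ι : Level} {I : Set ι} → (I → Carrier) → Carrier → Set (c ⊔ ℓ₂ ⊔ ι)
  IsGlb {I = I} f x = ((i : I) → x ≤ f i) × ((y : Carrier) → ((i : I) → y ≤ f i) → y ≤ x)

  IsComplete : (κ : Level) → Set (c ⊔ ℓ₂ ⊔ suc κ)
  IsComplete κ = (I : Set κ) (f : I → Carrier) →
                 Σ Carrier (IsLub f) × Σ Carrier (IsGlb f)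

  IsClosedUnderJoinsMeets : {ζ : Level} → (Carrier → Set ζ) → (κ : Level) →
                            Set (c ⊔ ℓ₂ ⊔ ζ ⊔ suc κ)
  IsClosedUnderJoinsMeets Z κ =
    ((I : Set κ) (f : I → Carrier) → ((i : I) → Z (f i)) →
       (x : Carrier) → IsLub f x → Z x)
    × ((I : Set κ) (f : I → Carrier) → ((i : I) → Z (f i)) →
       (x : Carrier) → IsGlb f x → Z x)

IsMacNeilleCompletion : {c ℓ₁ ℓ₂ c' ℓ₁' ℓ₂' : Level} →
  (P : Poset c ℓ₁ ℓ₂) (Q : Poset c' ℓ₁' ℓ₂') →
  (Poset.Carrier P → Poset.Carrier Q) → (κ : Level) →
  Set (c ⊔ ℓ₂ ⊔ c' ⊔ ℓ₂' ⊔ suc κ)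
IsMacNeilleCompletion P Q e κ =
  IsComplete Q κ
  × ((a b : P.Carrier) → (a P.≤ b → e a Q.≤ e b) × (e a Q.≤ e b → a P.≤ b))
  × ((x : Q.Carrier) →
       IsLub Q {I = Σ P.Carrier (λ a → e a Q.≤ x)} (λ p → e (proj₁ p)) x)
  × ((x : Q.Carrier) →
       IsGlb Q {I = Σ P.Carrier (λ a → x Q.≤ e a)} (λ p → e (proj₁ p)) x)
  where
    module P = Poset P
    module Q = Poset Q

module _ {c ℓ₁ ℓ₂ : Level} (D : BoundedLattice c ℓ₁ ℓ₂) where
  open BoundedLattice D

  -- x is complemented (belongs to the centre Z(D))
  IsCentral : Carrier → Set (c ⊔ ℓ₁)
  IsCentral x = Σ Carrier (λ y → (x ∨ y ≈ ⊤) × (x ∧ y ≈ ⊥))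

  centrePoset : Poset (c ⊔ ℓ₁) ℓ₁ ℓ₂
  centrePoset = On.poset poset (proj₁ {B = IsCentral})

  IsSupplement : Carrier → Carrier → Set (c ⊔ ℓ₁ ⊔ ℓ₂)
  IsSupplement a s = (a ∨ s ≈ ⊤) × ((y : Carrier) → a ∨ y ≈ ⊤ → s ≤ y)

  IsCentrallySupplemented : Set (c ⊔ ℓ₁ ⊔ ℓ₂)
  IsCentrallySupplemented =
    Σ (Carrier → Carrier) λ sup →
      ((a : Carrier) → IsSupplement a (sup a))
      × ((x y : Carrier) → sup (x ∨ y) ≈ sup x ∧ sup y)

module Submission where

-- The supplement b⁺ of any b ∈ A is central (its complement is b⁺⁺), and
-- a ≤ (¬a)⁺, ¬(b⁺) ≤ b⁺⁺ ≤ b.  On the completion side, density of e turns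
-- two facts about A into facts about Ā: e(¬a) is the largest element
-- disjoint from e a, and e(b⁺) lies below every x with x ∨ e b = ⊤.
--
-- With these, if fᵢ, gᵢ are complementary in Ā for every i, then ⋁ fᵢ and
-- ⋀ gᵢ are complementary; hence Z(Ā) is closed under arbitrary joins and
-- meets, so it is complete.  A central x ∈ Ā above e a lies above the
-- central e((¬a)⁺) ≥ e a, and a central x below e b lies below the central
-- e(b⁺⁺) ≤ e b; so e(Z(A)) is join- and meet-dense in Z(Ā), i.e. Z(Ā) is
-- the MacNeille completion of Z(A).

open import Defs
open import Level using (Level; _⊔_)
open import Data.Product using (Σ; _×_; _,_; proj₁; proj₂)
open import Relation.Binary.Lattice.Bundles using (BoundedLattice; HeytingAlgebra)
import Relation.Binary.Lattice.Properties.HeytingAlgebra as HeytingProperties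
import Relation.Binary.Lattice.Properties.JoinSemilattice as JoinProperties
import Relation.Binary.Lattice.Properties.MeetSemilattice as MeetProperties
import Relation.Binary.Reasoning.PartialOrder as ≤-Reasoning

-- Complementary pairs in an arbitrary bounded lattice; IsCentral L x is
-- definitionally Σ y, Complementary x y.
module ComplementaryPairs {c ℓ₁ ℓ₂ : Level} (L : BoundedLattice c ℓ₁ ℓ₂) where
  open BoundedLattice L
  open JoinProperties joinSemilattice using (∨-monotonic; ∨-comm)
  open MeetProperties meetSemilattice using (∧-monotonic; ∧-comm)

  Complementary : Carrier → Carrier → Set ℓ₁
  Complementary x y = (x ∨ y ≈ ⊤) × (x ∧ y ≈ ⊥)

  complementary-sym : ∀ {x y} → Complementary x y → Complementary y x
  complementary-sym (x∨y≈⊤ , x∧y≈⊥) =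
    Eq.trans (∨-comm _ _) x∨y≈⊤ , Eq.trans (∧-comm _ _) x∧y≈⊥

  ⊤-enlarge : ∀ {x y x' y'} → Complementary x y → x ≤ x' → y ≤ y' → ⊤ ≤ x' ∨ y'
  ⊤-enlarge (x∨y≈⊤ , _) x≤x' y≤y' = trans (reflexive (Eq.sym x∨y≈⊤)) (∨-monotonic x≤x' y≤y')

  ⊥-shrink : ∀ {x y x' y'} → Complementary x y → x' ≤ x → y' ≤ y → x' ∧ y' ≤ ⊥
  ⊥-shrink (_ , x∧y≈⊥) x'≤x y'≤y = trans (∧-monotonic x'≤x y'≤y) (reflexive x∧y≈⊥)

  complementary : ∀ {x y} → ⊤ ≤ x ∨ y → x ∧ y ≤ ⊥ → Complementary x y
  complementary ⊤≤x∨y x∧y≤⊥ = antisym (maximum _) ⊤≤x∨y , antisym x∧y≤⊥ (minimum _)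

module HeytingFacts {c ℓ₁ ℓ₂ : Level} (A : HeytingAlgebra c ℓ₁ ℓ₂) where
  open HeytingAlgebra A
  open HeytingProperties A using (¬_; ⇨-eval; ∧-distribˡ-∨-≤)
  open ≤-Reasoning poset

  disjoint-below-cover : ∀ {p q r} → p ∧ q ≤ ⊥ → ⊤ ≤ q ∨ r → p ≤ r
  disjoint-below-cover {p} {q} {r} p∧q≤⊥ ⊤≤q∨r = begin
    p                 ≤⟨ ∧-greatest refl (trans (maximum p) ⊤≤q∨r) ⟩
    p ∧ (q ∨ r)       ≤⟨ ∧-distribˡ-∨-≤ p q r ⟩
    (p ∧ q) ∨ (p ∧ r) ≤⟨ ∨-least (trans p∧q≤⊥ (minimum r)) (x∧y≤y p r) ⟩
    r                 ∎

  ∧-¬-≤⊥ : ∀ a → a ∧ ¬ a ≤ ⊥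
  ∧-¬-≤⊥ a = trans (∧-greatest (x∧y≤y _ _) (x∧y≤x _ _)) ⇨-eval

  ≤¬⇒≤⊥ : ∀ {a} → a ≤ ¬ a → a ≤ ⊥
  ≤¬⇒≤⊥ {a} a≤¬a = trans (∧-greatest refl a≤¬a) (∧-¬-≤⊥ a)

module Supplements {c ℓ₁ ℓ₂ : Level} (A : HeytingAlgebra c ℓ₁ ℓ₂)
    (CS : IsCentrallySupplemented (HeytingAlgebra.boundedLattice A)) where
  open HeytingAlgebra A
  open HeytingProperties A using (¬_; ⇨-eval)
  open HeytingFacts A
  open ComplementaryPairs boundedLattice using (complementary)

  _⁺ : Carrier → Carrier
  _⁺ = proj₁ CS

  ⁺-covers : ∀ b → ⊤ ≤ b ∨ b ⁺
  ⁺-covers b = reflexive (Eq.sym (proj₁ (proj₁ (proj₂ CS) b)))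

  ⁺-least : ∀ {b y} → ⊤ ≤ b ∨ y → b ⁺ ≤ y
  ⁺-least {b} {y} ⊤≤b∨y = proj₂ (proj₁ (proj₂ CS) b) y (antisym (maximum _) ⊤≤b∨y)

  -- b⁺ ∧ b⁺⁺ = (b ∨ b⁺)⁺ = ⊤⁺ = ⊥, so b⁺⁺ is a complement of b⁺
  ⁺-central : ∀ b → IsCentral boundedLattice (b ⁺)
  ⁺-central b = (b ⁺) ⁺ , complementary (⁺-covers (b ⁺)) disjoint
    where
    disjoint : b ⁺ ∧ (b ⁺) ⁺ ≤ ⊥
    disjoint = trans (reflexive (Eq.sym (proj₂ (proj₂ CS) b (b ⁺))))
                     (⁺-least (trans (⁺-covers b) (x≤x∨y _ _)))

  ≤¬⁺ : ∀ a → a ≤ (¬ a) ⁺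
  ≤¬⁺ a = disjoint-below-cover (∧-¬-≤⊥ a) (⁺-covers (¬ a))

  ⁺⁺≤ : ∀ b → (b ⁺) ⁺ ≤ b
  ⁺⁺≤ b = ⁺-least (trans (⁺-covers b) (∨-least (y≤x∨y _ _) (x≤x∨y _ _)))

  ¬⁺≤⁺⁺ : ∀ b → ¬ (b ⁺) ≤ (b ⁺) ⁺
  ¬⁺≤⁺⁺ b = disjoint-below-cover ⇨-eval (⁺-covers (b ⁺))

  ⁺≤⇒⊤ : ∀ {u} → u ⁺ ≤ u → ⊤ ≤ u
  ⁺≤⇒⊤ {u} u⁺≤u = trans (⁺-covers u) (∨-least refl u⁺≤u)

module Completion {c ℓ₁ ℓ₂ c' ℓ₁' ℓ₂' κ : Level}
    (A : HeytingAlgebra c ℓ₁ ℓ₂) (Ā : BoundedLattice c' ℓ₁' ℓ₂')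
    (e : HeytingAlgebra.Carrier A → BoundedLattice.Carrier Ā)
    (MN : IsMacNeilleCompletion (HeytingAlgebra.poset A) (BoundedLattice.poset Ā) e κ) where
  private module A = HeytingAlgebra A
  open BoundedLattice Ā
  open HeytingProperties A using (¬_)
  open ComplementaryPairs Ā using (complementary)

  Ā-complete : IsComplete poset κ
  Ā-complete = proj₁ MN

  mono : ∀ {a b} → a A.≤ b → e a ≤ e b
  mono {a} {b} = proj₁ (proj₁ (proj₂ MN) a b)

  reflect : ∀ {a b} → e a ≤ e b → a A.≤ b
  reflect {a} {b} = proj₂ (proj₁ (proj₂ MN) a b)

  join-dense : (x : Carrier) → IsLub poset {I = Σ A.Carrier (λ a → e a ≤ x)} (λ p → e (proj₁ p)) x
  join-dense = proj₁ (proj₂ (proj₂ MN))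

  meet-dense : (x : Carrier) → IsGlb poset {I = Σ A.Carrier (λ a → x ≤ e a)} (λ p → e (proj₁ p)) x
  meet-dense = proj₂ (proj₂ (proj₂ MN))

  below-by-density : ∀ {z y} → (∀ a → e a ≤ z → e a ≤ y) → z ≤ y
  below-by-density {z} {y} h = proj₂ (join-dense z) y (λ p → h (proj₁ p) (proj₂ p))

  above-by-density : ∀ {z y} → (∀ a → z ≤ e a → y ≤ e a) → y ≤ z
  above-by-density {z} {y} h = proj₂ (meet-dense z) y (λ p → h (proj₁ p) (proj₂ p))

  ⊤-by-density : ∀ {z} → (∀ u → z ≤ e u → A.⊤ A.≤ u) → ⊤ ≤ z
  ⊤-by-density h = above-by-density (λ u z≤eu → trans ⊤≤e⊤ (mono (h u z≤eu)))
    where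
    ⊤≤e⊤ : ⊤ ≤ e A.⊤
    ⊤≤e⊤ = below-by-density (λ a _ → mono (A.maximum a))

  ⊥-by-density : ∀ {z} → (∀ a → e a ≤ z → a A.≤ A.⊥) → z ≤ ⊥
  ⊥-by-density h = below-by-density (λ a ea≤z → trans (mono (h a ea≤z)) e⊥≤⊥)
    where
    e⊥≤⊥ : e A.⊥ ≤ ⊥
    e⊥≤⊥ = above-by-density (λ a _ → mono (A.minimum a))

  ≤e¬ : ∀ {z a} → z ∧ e a ≤ ⊥ → z ≤ e (¬ a)
  ≤e¬ {z} {a} z∧ea≤⊥ = below-by-density (λ b eb≤z → mono (A.transpose-⇨ (reflect
    (trans (∧-greatest (trans (mono (A.x∧y≤x b a)) eb≤z) (mono (A.x∧y≤y b a)))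
           (trans z∧ea≤⊥ (minimum _))))))

  preserves-central : ∀ {a} → IsCentral A.boundedLattice a → IsCentral Ā (e a)
  preserves-central {a} (b , a∨b≈⊤ , a∧b≈⊥) = e b , complementary
    (⊤-by-density (λ u ea∨eb≤eu → A.trans (A.reflexive (A.Eq.sym a∨b≈⊤))
       (A.∨-least (reflect (trans (x≤x∨y _ _) ea∨eb≤eu))
                  (reflect (trans (y≤x∨y _ _) ea∨eb≤eu)))))
    (⊥-by-density (λ d ed≤ea∧eb → A.trans
       (A.∧-greatest (reflect (trans ed≤ea∧eb (x∧y≤x _ _)))
                     (reflect (trans ed≤ea∧eb (x∧y≤y _ _))))
       (A.reflexive a∧b≈⊥)))

module Centre {c ℓ₁ ℓ₂ c' ℓ₁' ℓ₂' κ : Level}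
    (A : HeytingAlgebra c ℓ₁ ℓ₂) (Ā : BoundedLattice c' ℓ₁' ℓ₂')
    (e : HeytingAlgebra.Carrier A → BoundedLattice.Carrier Ā)
    (CS : IsCentrallySupplemented (HeytingAlgebra.boundedLattice A))
    (MN : IsMacNeilleCompletion (HeytingAlgebra.poset A) (BoundedLattice.poset Ā) e κ) where
  module A = HeytingAlgebra A
  open BoundedLattice Ā
  open HeytingProperties A using (¬_)
  open HeytingFacts A using (≤¬⇒≤⊥)
  open Supplements A CS
  open Completion A Ā e MN
  open ComplementaryPairs Ā

  ZA : Set (c ⊔ ℓ₁)
  ZA = Σ A.Carrier (IsCentral A.boundedLattice)

  e⁺-below : ∀ {x b} → ⊤ ≤ x ∨ e b → e (b ⁺) ≤ x
  e⁺-below {x} {b} ⊤≤x∨eb = above-by-density (λ u x≤eu → mono (⁺-least (reflect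
    (trans (maximum _) (trans ⊤≤x∨eb
      (∨-least (trans x≤eu (mono (A.y≤x∨y b u))) (mono (A.x≤x∨y b u))))))))

  join-meet-complementary : {I : Set κ} (f g : I → Carrier) →
    (∀ i → Complementary (f i) (g i)) → ∀ {x y} →
    IsLub poset f x → IsGlb poset g y → Complementary x y
  join-meet-complementary f g fg {x} {y} (f≤x , x-least) (y≤g , y-greatest) =
    complementary (⊤-by-density covered) (⊥-by-density disjoint)
    where
    -- e(u⁺) ≤ gᵢ for all i, hence e(u⁺) ≤ y ≤ e u
    covered : ∀ u → x ∨ y ≤ e u → A.⊤ A.≤ u
    covered u x∨y≤eu = ⁺≤⇒⊤ (reflect (trans
      (y-greatest (e (u ⁺)) (λ i → e⁺-below (⊤-enlarge (complementary-sym (fg i)) refl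
        (trans (f≤x i) (trans (x≤x∨y x y) x∨y≤eu)))))
      (trans (y≤x∨y x y) x∨y≤eu)))
    -- fᵢ ≤ e(¬a) for all i, hence e a ≤ x ≤ e(¬a)
    disjoint : ∀ a → e a ≤ x ∧ y → a A.≤ A.⊥
    disjoint a ea≤x∧y = ≤¬⇒≤⊥ (reflect (trans ea≤x∧y (trans (x∧y≤x x y)
      (x-least (e (¬ a)) (λ i → ≤e¬ (⊥-shrink (fg i) refl
        (trans ea≤x∧y (trans (x∧y≤y x y) (y≤g i)))))))))

  -- Z(Ā) is closed under all joins and meets: pair a family with its
  -- complements and take the dual bound of the complements
  closed-under-joins-meets : IsClosedUnderJoinsMeets poset (IsCentral Ā) κ
  closed-under-joins-meets = closed-joins , closed-meets
    where
    closed-joins : (I : Set κ) (f : I → Carrier) → (∀ i → IsCentral Ā (f i)) →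
                   (x : Carrier) → IsLub poset f x → IsCentral Ā x
    closed-joins I f fc x x-lub =
      let (y , y-glb) = proj₂ (Ā-complete I (λ i → proj₁ (fc i)))
      in y , join-meet-complementary f _ (λ i → proj₂ (fc i)) x-lub y-glb
    closed-meets : (I : Set κ) (f : I → Carrier) → (∀ i → IsCentral Ā (f i)) →
                   (x : Carrier) → IsGlb poset f x → IsCentral Ā x
    closed-meets I f fc x x-glb =
      let (y , y-lub) = proj₁ (Ā-complete I (λ i → proj₁ (fc i)))
      in y , complementary-sym (join-meet-complementary _ f
               (λ i → complementary-sym (proj₂ (fc i))) y-lub x-glb)

  -- a central x above e a lies above the central e((¬a)⁺), and a ≤ (¬a)⁺
  central-above : ∀ {x} → IsCentral Ā x → ∀ a → e a ≤ x →
    Σ ZA (λ q → (a A.≤ proj₁ q) × (e (proj₁ q) ≤ x))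
  central-above (x' , xx') a ea≤x = ((¬ a) ⁺ , ⁺-central (¬ a)) , ≤¬⁺ a ,
    e⁺-below (⊤-enlarge xx' refl (≤e¬ (⊥-shrink (complementary-sym xx') refl ea≤x)))

  -- a central x below e b lies below the central e(b⁺⁺), and b⁺⁺ ≤ b
  central-below : ∀ {x} → IsCentral Ā x → ∀ b → x ≤ e b →
    Σ ZA (λ q → (proj₁ q A.≤ b) × (x ≤ e (proj₁ q)))
  central-below (x' , xx') b x≤eb = ((b ⁺) ⁺ , ⁺-central (b ⁺)) , ⁺⁺≤ b ,
    trans (≤e¬ (⊥-shrink xx' refl
            (e⁺-below (⊤-enlarge (complementary-sym xx') refl x≤eb))))
          (mono (¬⁺≤⁺⁺ b))

  eZ : (a : A.Carrier) → IsCentral A.boundedLattice a → IsCentral Ā (e a)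
  eZ a = preserves-central

  -- Z(Ā) is complete by closedness, and the two density statements follow
  -- from those of Ā via central-above and central-below
  centre-is-completion : IsMacNeilleCompletion (centrePoset A.boundedLattice) (centrePoset Ā)
                           (λ q → (e (proj₁ q) , eZ (proj₁ q) (proj₂ q))) κ
  centre-is-completion = complete , (λ _ _ → mono , reflect) , join-dense-Z , meet-dense-Z
    where
    complete : IsComplete (centrePoset Ā) κ
    complete I f =
      let (x , x-lub) = proj₁ (Ā-complete I (λ i → proj₁ (f i)))
          (m , m-glb) = proj₂ (Ā-complete I (λ i → proj₁ (f i)))
          closed-joins , closed-meets = closed-under-joins-meets
      in ((x , closed-joins I _ (λ i → proj₂ (f i)) x x-lub) ,
            proj₁ x-lub , (λ y → proj₂ x-lub (proj₁ y)))
       , ((m , closed-meets I _ (λ i → proj₂ (f i)) m m-glb) ,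
            proj₁ m-glb , (λ y → proj₂ m-glb (proj₁ y)))
    join-dense-Z : (x : Σ Carrier (IsCentral Ā)) →
      IsLub (centrePoset Ā) {I = Σ ZA (λ q → e (proj₁ q) ≤ proj₁ x)}
            (λ p → (e (proj₁ (proj₁ p)) , eZ _ (proj₂ (proj₁ p)))) x
    join-dense-Z (x , xc) = proj₂ , λ y ub → below-by-density (λ a ea≤x →
      let (q , a≤q , eq≤x) = central-above xc a ea≤x
      in trans (mono a≤q) (ub (q , eq≤x)))
    meet-dense-Z : (x : Σ Carrier (IsCentral Ā)) →
      IsGlb (centrePoset Ā) {I = Σ ZA (λ q → proj₁ x ≤ e (proj₁ q))}
            (λ p → (e (proj₁ (proj₁ p)) , eZ _ (proj₂ (proj₁ p)))) x
    meet-dense-Z (x , xc) = proj₂ , λ y lb → above-by-density (λ b x≤eb →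
      let (q , q≤b , x≤eq) = central-below xc b x≤eb
      in trans (lb (q , x≤eq)) (mono q≤b))

proposition2p10 : {c ℓ₁ ℓ₂ c' ℓ₁' ℓ₂' κ : Level}
    (A : HeytingAlgebra c ℓ₁ ℓ₂) (Ā : BoundedLattice c' ℓ₁' ℓ₂')
    (e : HeytingAlgebra.Carrier A → BoundedLattice.Carrier Ā) →
    IsCentrallySupplemented (HeytingAlgebra.boundedLattice A) →
    IsMacNeilleCompletion (HeytingAlgebra.poset A) (BoundedLattice.poset Ā) e κ →
    Σ ((a : HeytingAlgebra.Carrier A) →
         IsCentral (HeytingAlgebra.boundedLattice A) a → IsCentral Ā (e a))
      (λ eZ → IsMacNeilleCompletion
                (centrePoset (HeytingAlgebra.boundedLattice A))
                (centrePoset Ā)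
                (λ q → (e (proj₁ q) , eZ (proj₁ q) (proj₂ q))) κ)
    × IsClosedUnderJoinsMeets (BoundedLattice.poset Ā) (IsCentral Ā) κ
proposition2p10 {κ = κ} A Ā e CS MN =
  (eZ , centre-is-completion) , closed-under-joins-meets
  where open Centre {κ = κ} A Ā e CS MN
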